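{- Let $Q$ be a precubical set, $n\ge1$ and $q\in Q_n$. (1) For $\alpha\in\{s,t\}$ and $i\in\{1,\dots,n\}$, $(\lambda_1(\alpha_i q),\dots,\lambda_{n-1}(\alpha_iq))=(\lambda_1(q),\dots,\lambda_{i-1}(q),\lambda_{i+1}(q),\dots,\lambda_n(q))$. (2) $\lambda_1(q)\lessdot\lambda_2(q)\lessdot\cdots\lessdot\lambda_n(q)$. (3) $Q$ is consistent if and only if for every $m$ and every $p\in Q_m$ the labels $\lambda_1(p),\dots,\lambda_m(p)$ are pairwise distinct. (4) If $Q$ is ordered, then $\lambda_i(q)\lessdot\lambda_j(q)$ implies $i<j$.
   Context: A precubical set is a family of pairwise disjoint sets $Q_n$ ($n\in\mathbb N$) with face maps $s_k,t_k:Q_n\to Q_{n-1}$ ($n\ge1$, $k=1,\dots,n$) satisfying $\alpha_k\beta_\ell=\beta_{\ell-1}\alpha_k$ for all $\alpha,\beta\in\{s,t\}$ and $k<\ell$. Let $\approx$ be the equivalence relation on $Q_1$ generated by the pairs $(s_iq,t_iq)$ for $q\in Q_2$, $i\in\{1,2\}$; $\mathcal U(Q)=Q_1/\approx$ and $\lambda(e)$ denotes the class of $e\in Q_1$. For $q\in Q_n$ and $i\in\{1,\dots,n\}$, $\lambda_i(q)=\lambda(s_1s_2\cdots s_{i-1}s_{i+1}\cdots s_n(q))$. The relation $\lessdot$ on $\mathcal U(Q)$ is the transitive closure of $\{(\lambda(s_2q),\lambda(s_1q)):q\in Q_2\}$. $Q$ is consistent if there is no $q\in Q_2$ with $s_1q\approx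 s_2q$. $Q$ is ordered if there are no $a,b\in\mathcal U(Q)$ with both $a\lessdot b$ and $b\lessdot a$. -}

module Defs where

open import Data.Nat using (ℕ; zero; suc)
import Data.Nat as ℕ
open import Data.Fin using (Fin; zero; suc; toℕ; fromℕ; inject₁; lower₁; _≤_)
open import Data.Product using (Σ; _×_; _,_)
open import Relation.Binary.PropositionalEquality using (_≡_)
open import Relation.Nullary using (¬_; yes; no)

data Dir : Set where
  S T : Dir

-- Face maps are indexed 0-based: d α k with k : Fin (suc n) is α_{k+1} : Q_{n+1} → Q_n.
record PrecubicalSet : Set₁ where
  field
    Q : ℕ → Set
    d : Dir → ∀ {n} → Fin (suc n) → Q (suc n) → Q n
    -- α_k β_ℓ = β_{ℓ-1} α_k for k < ℓ  (1-based k = k'+1, ℓ = j+2, k < ℓ ⟺ k' ≤ j)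
    cubical : ∀ (α β : Dir) {m} (k j : Fin (suc m)) → k ≤ j → (x : Q (suc (suc m))) →
              d α k (d β (suc j) x) ≡ d β j (d α (inject₁ k) x)

module _ (P : PrecubicalSet) where
  open PrecubicalSet P

  -- the equivalence relation ≈ on Q₁ generated by (s_i q, t_i q), q ∈ Q₂.
  -- U(Q) = Q₁/≈ is represented by Q₁ with equality ≈ (λ(e) = λ(e') iff e ≈ e').
  data _≈_ : Q 1 → Q 1 → Set where
    gen    : (q : Q 2) (i : Fin 2) → d S i q ≈ d T i q
    ≈refl  : ∀ {a} → a ≈ a
    ≈sym   : ∀ {a b} → a ≈ b → b ≈ a
    ≈trans : ∀ {a b c} → a ≈ b → b ≈ c → a ≈ c

  -- ⋖ : transitive closure of {(λ(s₂ q), λ(s₁ q)) : q ∈ Q₂} on U(Q), lifted to representatives.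
  data _⋖_ : Q 1 → Q 1 → Set where
    step   : ∀ {a b} (q : Q 2) → a ≈ d S (suc zero) q → d S zero q ≈ b → a ⋖ b
    ⋖trans : ∀ {a b c} → a ⋖ b → b ⋖ c → a ⋖ c

  -- s_1 s_2 ⋯ s_j applied to x ∈ Q_{j+1} (s_j applied first)
  sfaces : ∀ j → Q (suc j) → Q 1
  sfaces zero x = x
  sfaces (suc j) x = sfaces j (d S (inject₁ (fromℕ j)) x)

  -- lab' n i q = s_1 ⋯ s_{i} s_{i+2} ⋯ s_{n+1} q  for q ∈ Q_{n+1}, i : Fin (n+1) (0-based)
  lab' : ∀ n → Fin (suc n) → Q (suc n) → Q 1
  lab' zero _ q = q
  lab' (suc n) i q with suc n ℕ.≟ toℕ i
  ... | yes _ = sfaces (suc n) q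
  ... | no ne = lab' n (lower₁ i ne) (d S (fromℕ (suc n)) q)

  -- λ_i(q) (as a representative edge; i 0-based)
  lab : ∀ {n} → Fin n → Q n → Q 1
  lab {suc n} i q = lab' n i q

  Consistent : Set
  Consistent = ¬ (Σ (Q 2) λ q → d S zero q ≈ d S (suc zero) q)

  Ordered : Set
  Ordered = ∀ a b → ¬ ((a ⋖ b) × (b ⋖ a))

module Submission where

-- The label λ_j(q) of q ∈ Q_{n+1} is the edge obtained by applying s-faces in
-- every direction except j.  The geometric heart of the proof is the 2-dimensional face
-- 'square n x' of x ∈ Q_{n+2} spanned by its last two directions: the labels
-- met along the recursion are its edges α_1 and α_2, which gives
--   * independence of the direction α up to ≈ (the generators of ≈), and
--   * the basic step λ_{n+1}(s_{n+2} x) ⋖ λ_{n+2}(x) (the generators of ⋖).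
-- From these, induction on the dimension with the cubical identities proves
-- (1) λ_j(α_i q) ≈ λ_{punchIn i j}(q) and (2) λ_j(q) ⋖ λ_{j+1}(q).
-- (3) follows from (1): two equal labels survive in a common 2-dimensional
-- s-face, whose labels are s_2 r and s_1 r.  (4) follows from (2) by chaining
-- the consecutive steps with transitivity of ⋖.

open import Defs
open import Data.Nat using (ℕ; zero; suc; z≤n; s≤s)
import Data.Nat as ℕ
open import Data.Fin using (Fin; zero; suc; toℕ; inject₁; punchIn; punchOut; fromℕ; _<_; _≤_)
open import Data.Fin.Properties
  using (toℕ-fromℕ; toℕ-inject₁-≢; lower₁-inject₁′; ≤fromℕ; ≤-refl; <-cmp; punchIn-punchOut; punchOut-injective)
open import Data.Product using (Σ; _×_; _,_)
open import Data.Empty using (⊥-elim)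
open import Relation.Binary.Definitions using (tri<; tri≈; tri>)
open import Relation.Binary.PropositionalEquality using (_≡_; _≢_; refl; sym; trans; cong; subst; subst₂)
open import Relation.Nullary using (¬_; yes; no)
open import Function.Bundles using (_⇔_; mk⇔)

data LastOrInject : ∀ {n} → Fin (suc n) → Set where
  last   : ∀ {n} → LastOrInject (fromℕ n)
  inject : ∀ {n} (i : Fin n) → LastOrInject (inject₁ i)

lastOrInject : ∀ {n} (i : Fin (suc n)) → LastOrInject i
lastOrInject {zero}  zero    = last
lastOrInject {suc n} zero    = inject zero
lastOrInject {suc n} (suc i) with lastOrInject i
... | last     = last
... | inject j = inject (suc j)

punchIn-last : ∀ {n} (j : Fin n) → punchIn (fromℕ n) j ≡ inject₁ j
punchIn-last {suc n} zero    = refl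
punchIn-last {suc n} (suc j) = cong suc (punchIn-last j)

punchIn-inject₁-last : ∀ {n} (i : Fin (suc n)) → punchIn (inject₁ i) (fromℕ n) ≡ fromℕ (suc n)
punchIn-inject₁-last {zero}  zero    = refl
punchIn-inject₁-last {suc n} zero    = refl
punchIn-inject₁-last {suc n} (suc i) = cong suc (punchIn-inject₁-last i)

punchIn-inject₁ : ∀ {n} (i : Fin (suc n)) (j : Fin n) → punchIn (inject₁ i) (inject₁ j) ≡ inject₁ (punchIn i j)
punchIn-inject₁ zero    j       = refl
punchIn-inject₁ (suc i) zero    = refl
punchIn-inject₁ (suc i) (suc j) = cong suc (punchIn-inject₁ i j)

inject₁-≤-inject₁-fromℕ : ∀ {n} (i : Fin (suc n)) → inject₁ i ≤ inject₁ (fromℕ n)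
inject₁-≤-inject₁-fromℕ {zero}  zero    = z≤n
inject₁-≤-inject₁-fromℕ {suc n} zero    = z≤n
inject₁-≤-inject₁-fromℕ {suc n} (suc i) = s≤s (inject₁-≤-inject₁-fromℕ i)

avoiding : ∀ {n} (i j : Fin (suc (suc (suc n)))) → Σ (Fin (suc (suc (suc n)))) λ k → (k ≢ i) × (k ≢ j)
avoiding zero          zero          = suc zero , (λ ()) , (λ ())
avoiding zero          (suc zero)    = suc (suc zero) , (λ ()) , (λ ())
avoiding zero          (suc (suc j)) = suc zero , (λ ()) , (λ ())
avoiding (suc zero)    zero          = suc (suc zero) , (λ ()) , (λ ())
avoiding (suc zero)    (suc j)       = zero , (λ ()) , (λ ())
avoiding (suc (suc i)) zero          = suc zero , (λ ()) , (λ ())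
avoiding (suc (suc i)) (suc j)       = zero , (λ ()) , (λ ())

consecutive⇒increasing : ∀ {a r} {A : Set a} (R : A → A → Set r) →
  (∀ {x y z} → R x y → R y z → R x z) →
  ∀ {n} (f : Fin (suc n) → A) → (∀ k → R (f (inject₁ k)) (f (suc k))) →
  ∀ (i j : Fin (suc n)) → i < j → R (f i) (f j)
consecutive⇒increasing R R-trans {suc n} f next zero (suc zero) _ = next zero
consecutive⇒increasing R R-trans {suc n} f next zero (suc (suc j)) _ =
  R-trans (next zero) (consecutive⇒increasing R R-trans (λ k → f (suc k)) (λ k → next (suc k)) zero (suc j) (s≤s z≤n))
consecutive⇒increasing R R-trans {suc n} f next (suc i) (suc j) (s≤s i<j) =
  consecutive⇒increasing R R-trans (λ k → f (suc k)) (λ k → next (suc k)) i j i<j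

module _ (P : PrecubicalSet) where
  open PrecubicalSet P

  infix 4 _≈ᴾ_ _⋖ᴾ_

  _≈ᴾ_ : Q 1 → Q 1 → Set
  _≈ᴾ_ = _≈_ P

  _⋖ᴾ_ : Q 1 → Q 1 → Set
  _⋖ᴾ_ = _⋖_ P

  ≡⇒≈ : ∀ {a b} → a ≡ b → a ≈ᴾ b
  ≡⇒≈ refl = ≈refl

  face-direction : ∀ α (r : Q 2) k → d α k r ≈ᴾ d S k r
  face-direction S r k = ≈refl
  face-direction T r k = ≈sym (gen r k)

  label-last : ∀ n (q : Q (suc n)) → lab P (fromℕ n) q ≡ sfaces P n q
  label-last zero    q = refl
  label-last (suc n) q with suc n ℕ.≟ toℕ (fromℕ (suc n))
  ... | yes _ = refl
  ... | no ne = ⊥-elim (ne (sym (toℕ-fromℕ (suc n))))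

  label-inject : ∀ n (i : Fin (suc n)) (q : Q (suc (suc n))) →
                 lab P (inject₁ i) q ≡ lab P i (d S (fromℕ (suc n)) q)
  label-inject n i q with suc n ℕ.≟ toℕ (inject₁ i)
  ... | yes e = ⊥-elim (toℕ-inject₁-≢ i e)
  ... | no ne = cong (λ k → lab P k (d S (fromℕ (suc n)) q)) (lower₁-inject₁′ i ne)

  -- The 2-dimensional face s_1 ⋯ s_n x of x ∈ Q_{n+2}, spanned by its last two directions.
  square : ∀ n → Q (suc (suc n)) → Q 2
  square zero    x = x
  square (suc n) x = square n (d S (inject₁ (inject₁ (fromℕ n))) x)

  square-second-face : ∀ n α (x : Q (suc (suc n))) →
                       sfaces P n (d α (fromℕ (suc n)) x) ≡ d α (suc zero) (square n x)
  square-second-face zero    α x = refl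
  square-second-face (suc n) α x =
    trans (cong (sfaces P n) (cubical S α k (fromℕ (suc n)) (≤fromℕ k) x))
          (square-second-face n α (d S (inject₁ k) x))
    where k = inject₁ (fromℕ n)

  square-first-face : ∀ n α (x : Q (suc (suc n))) →
                      sfaces P n (d α (inject₁ (fromℕ n)) x) ≡ d α zero (square n x)
  square-first-face zero    α x = refl
  square-first-face (suc n) α x =
    trans (cong (sfaces P n) (cubical S α k k ≤-refl x))
          (square-first-face n α (d S (inject₁ k) x))
    where k = inject₁ (fromℕ n)

  last-label-of-last-face : ∀ n α (x : Q (suc (suc n))) →
                            sfaces P n (d α (fromℕ (suc n)) x) ≈ᴾ sfaces P n (d S (fromℕ (suc n)) x)
  last-label-of-last-face n α x =
    subst₂ _≈ᴾ_ (sym (square-second-face n α x)) (sym (square-second-face n S x))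
           (face-direction α (square n x) (suc zero))

  last-label-of-inner-face : ∀ n α (i : Fin (suc n)) (x : Q (suc (suc n))) →
                             sfaces P n (d α (inject₁ i) x) ≈ᴾ sfaces P (suc n) x
  last-label-of-inner-face n α i x with lastOrInject i
  ... | last =
    subst₂ _≈ᴾ_ (sym (square-first-face n α x)) (sym (square-first-face n S x))
           (face-direction α (square n x) zero)
  last-label-of-inner-face (suc n) α _ x | inject i =
    subst (_≈ᴾ sfaces P (suc (suc n)) x)
          (cong (sfaces P n) (cubical α S (inject₁ i) (inject₁ (fromℕ n)) (inject₁-≤-inject₁-fromℕ i) x))
          (last-label-of-inner-face n α i (d S (inject₁ (fromℕ (suc n))) x))

  labels-of-last-face : ∀ n α (j : Fin (suc n)) (x : Q (suc (suc n))) →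
                        lab P j (d α (fromℕ (suc n)) x) ≈ᴾ lab P j (d S (fromℕ (suc n)) x)
  labels-of-last-face n α j x with lastOrInject j
  ... | last =
    subst₂ _≈ᴾ_ (sym (label-last n _)) (sym (label-last n _)) (last-label-of-last-face n α x)
  labels-of-last-face (suc n) α _ x | inject j =
    ≈trans (≡⇒≈ (through-second-last α))
           (≈trans (labels-of-last-face n α j y) (≈sym (≡⇒≈ (through-second-last S))))
    where
      k = fromℕ (suc n)
      y = d S (inject₁ k) x
      -- the last face α_{n+3} commutes with the s-face s_{n+2} that computes label j
      through-second-last : ∀ β → lab P (inject₁ j) (d β (suc k) x) ≡ lab P j (d β k y)
      through-second-last β = trans (label-inject n j _) (cong (lab P j) (cubical S β k k ≤-refl x))

  labels-of-face : ∀ n α (i : Fin (suc n)) (j : Fin n) (q : Q (suc n)) →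
                   lab P j (d α i q) ≈ᴾ lab P (punchIn i j) q
  labels-of-face (suc n) α i j q with lastOrInject i
  ... | last =
    ≈trans (labels-of-last-face n α j q)
           (≈sym (≡⇒≈ (trans (cong (λ k → lab P k q) (punchIn-last j)) (label-inject n j q))))
  ... | inject i' with lastOrInject j
  ...   | last =
    subst₂ _≈ᴾ_ (sym (label-last n _))
                (sym (trans (cong (λ k → lab P k q) (punchIn-inject₁-last i')) (label-last (suc n) q)))
                (last-label-of-inner-face n α i' q)
  labels-of-face (suc (suc n)) α _ _ q | inject i' | inject j' =
    subst₂ _≈ᴾ_
      (sym (trans (label-inject n j' _) (cong (lab P j') (sym (cubical α S i' (fromℕ (suc n)) (≤fromℕ i') q)))))
      (sym (trans (cong (λ k → lab P k q) (punchIn-inject₁ i' j')) (label-inject (suc n) (punchIn i' j') q)))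
      (labels-of-face (suc n) α i' j' (d S (fromℕ (suc (suc n))) q))

  -- Part (2): consecutive labels increase; the base case is the square's own
  -- generator λ(s_2 r) ⋖ λ(s_1 r).
  consecutive-labels : ∀ n (q : Q (suc n)) (j : Fin n) → lab P (inject₁ j) q ⋖ᴾ lab P (suc j) q
  consecutive-labels (suc n) q j with lastOrInject j
  ... | last =
    subst₂ _⋖ᴾ_ (sym (trans (label-inject n (fromℕ n) q) (trans (label-last n _) (square-second-face n S q))))
                (sym (trans (label-last (suc n) q) (square-first-face n S q)))
                (step (square n q) ≈refl ≈refl)
  consecutive-labels (suc (suc n)) q _ | inject j =
    subst₂ _⋖ᴾ_ (sym (label-inject (suc n) (inject₁ j) q)) (sym (label-inject (suc n) (suc j) q))
           (consecutive-labels (suc n) (d S (fromℕ (suc (suc n))) q) j)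

  labels-increasing : ∀ n (q : Q (suc n)) (i j : Fin (suc n)) → i < j → lab P i q ⋖ᴾ lab P j q
  labels-increasing n q = consecutive⇒increasing _⋖ᴾ_ ⋖trans (λ k → lab P k q) (consecutive-labels n q)

  -- Two ≈-equal labels of a cube persist in a face avoiding both directions,
  -- down to a square r whose labels s_2 r and s_1 r are then ≈-equal.
  repeated-label⇒inconsistency : ∀ n (p : Q (suc (suc n))) (i j : Fin (suc (suc n))) →
    i ≢ j → lab P i p ≈ᴾ lab P j p → Σ (Q 2) λ r → d S zero r ≈ᴾ d S (suc zero) r
  repeated-label⇒inconsistency zero p zero    zero    i≢j _ = ⊥-elim (i≢j refl)
  repeated-label⇒inconsistency zero p zero    (suc zero) _ e = p , ≈sym e
  repeated-label⇒inconsistency zero p (suc zero) zero    _ e = p , e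
  repeated-label⇒inconsistency zero p (suc zero) (suc zero) i≢j _ = ⊥-elim (i≢j refl)
  repeated-label⇒inconsistency (suc n) p i j i≢j e with avoiding i j
  ... | k , k≢i , k≢j =
    repeated-label⇒inconsistency n (d S k p) (punchOut k≢i) (punchOut k≢j)
      (λ eq → i≢j (punchOut-injective k≢i k≢j eq))
      (≈trans (label-in-face k≢i) (≈trans e (≈sym (label-in-face k≢j))))
    where
      label-in-face : ∀ {l} (k≢l : k ≢ l) → lab P (punchOut k≢l) (d S k p) ≈ᴾ lab P l p
      label-in-face {l} k≢l =
        subst (λ t → lab P (punchOut k≢l) (d S k p) ≈ᴾ lab P t p) (punchIn-punchOut k≢l)
              (labels-of-face (suc (suc n)) S k (punchOut k≢l) p)

  consistent⇔distinct-labels :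
    Consistent P ⇔ (∀ (m : ℕ) (p : Q m) (i j : Fin m) → i ≢ j → ¬ lab P i p ≈ᴾ lab P j p)
  consistent⇔distinct-labels = mk⇔ distinct distinct⇒consistent
    where
      distinct : Consistent P → ∀ (m : ℕ) (p : Q m) (i j : Fin m) → i ≢ j → ¬ lab P i p ≈ᴾ lab P j p
      distinct c (suc zero)    p zero zero i≢j _ = i≢j refl
      distinct c (suc (suc n)) p i    j    i≢j e = c (repeated-label⇒inconsistency n p i j i≢j e)

      distinct⇒consistent : (∀ (m : ℕ) (p : Q m) (i j : Fin m) → i ≢ j → ¬ lab P i p ≈ᴾ lab P j p) → Consistent P
      distinct⇒consistent f (r , e) = f 2 r zero (suc zero) (λ ()) (≈sym e)

  -- Part (4): in an ordered precubical set, ⋖ between labels of one cube goes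
  -- upwards, since equal or decreasing indices would produce a ⋖-cycle.
  ordered⇒labels-ordered : Ordered P → ∀ n (q : Q (suc n)) (i j : Fin (suc n)) →
                           lab P i q ⋖ᴾ lab P j q → i < j
  ordered⇒labels-ordered ordered n q i j i⋖j with <-cmp i j
  ... | tri< i<j _ _ = i<j
  ... | tri≈ _ refl _ = ⊥-elim (ordered _ _ (i⋖j , i⋖j))
  ... | tri> _ _ j<i = ⊥-elim (ordered _ _ (i⋖j , labels-increasing n q j i j<i))

lemma2p2 : (P : PrecubicalSet) (n : ℕ) (q : PrecubicalSet.Q P (suc n)) →
    let open PrecubicalSet P in
    (∀ (α : Dir) (i : Fin (suc n)) (j : Fin n) →
       _≈_ P (lab P j (d α i q)) (lab P (punchIn i j) q))
    × (∀ (j : Fin n) → _⋖_ P (lab P (inject₁ j) q) (lab P (suc j) q))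
    × (Consistent P ⇔ (∀ (m : ℕ) (p : Q m) (i j : Fin m) → i ≢ j → ¬ _≈_ P (lab P i p) (lab P j p)))
    × (Ordered P → ∀ (i j : Fin (suc n)) → _⋖_ P (lab P i q) (lab P j q) → i < j)
lemma2p2 P n q =
    (λ α i j → labels-of-face P n α i j q)
  , consecutive-labels P n q
  , consistent⇔distinct-labels P
  , (λ ordered → ordered⇒labels-ordered P ordered n q)
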